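{- Let $(a_n)_{n\in\mathbf{N}}$ be a sequence in $\mathcal{C}$ and $k\ge1$. Then the prefix $w_a(0,k)$ has an optimal palindromic decomposition $w_a(0,k)=p_1p_2\cdots p_s$ such that no $p_i$ has length $3$, and moreover every $p_i$ of even length (viewed as the factor occurrence at its position) can be embedded into the center of a palindromic factor of the form $w_a(4z,4r)$ with $z,r\in\mathbf{N}$.
   Context: $w_a(x,y)=a_x\cdots a_{x+y-1}$. A word is a palindrome if it equals its reversal. An optimal palindromic decomposition of $w$ is a factorization into palindromes with the minimal number of factors. A factor $w_a(x,y)$ is embedded into the center of $w_a(X,Y)$ if $X\le x$, $x+y\le X+Y$ and $x-X=(X+Y)-(x+y)$. The class $\mathcal{C}$: let $\Sigma$ be an alphabet with at least two letters and $a\in\Sigma$. For a bijection $g$ of $\Sigma$ and a word $u$, $g(u)$ is the letter-by-letter image. Let $(f_n)_{n\ge0}$ be bijections of $\Sigma$ and define $w_0=a$, $w_n=w_{n-1}f_{n-1}(w_{n-1})f_{n-1}(w_{n-1})w_{n-1}$ for $n>0$, with the requirement $f_n(w_n)\neq w_n$ for all $n\ge0$. The limit infinite sequence is in $\mathcal{C}$; $\mathcal{C}$ is the set of all such limits. -}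

module Defs where

open import Data.Nat using (ℕ; zero; suc; _+_; _*_; _∸_; _^_; _≤_; _<_)
open import Data.List using (List; []; _∷_; map; reverse; upTo; length)
open import Data.Nat.ListAction using (sum)
open import Data.Product using (Σ; _×_; ∃; ∃-syntax)
open import Function.Bundles using (Inverse; _↔_)
open import Relation.Binary.PropositionalEquality using (_≡_; _≢_)

Word : Set → Set
Word A = List A

img : {A : Set} → A ↔ A → Word A → Word A
img g u = map (Inverse.to g) u

wSeq : {A : Set} → A → (ℕ → A ↔ A) → ℕ → Word A
wSeq x f zero = x ∷ []
wSeq x f (suc n) =
  let u = wSeq x f n ; v = img (f n) u in
  u Data.List.++ v Data.List.++ v Data.List.++ u

factor : {A : Set} → (ℕ → A) → ℕ → ℕ → Word A
factor a x y = map (λ i → a (x + i)) (upTo y)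

-- The infinite sequence a belongs to the class C: there are a letter x and
-- bijections f_n with f_n(w_n) ≠ w_n for all n, and a is the limit of (w_n),
-- i.e. every w_n is a prefix of a (|w_n| = 4^n).
InC : {A : Set} → (ℕ → A) → Set
InC {A} a = Σ A λ x → Σ (ℕ → A ↔ A) λ f →
  ((n : ℕ) → img (f n) (wSeq x f n) ≢ wSeq x f n) ×
  ((n : ℕ) → factor a 0 (4 ^ n) ≡ wSeq x f n)

Palindrome : {A : Set} → Word A → Set
Palindrome u = reverse u ≡ u

data PalDecomp {A : Set} (a : ℕ → A) : ℕ → List ℕ → Set where
  pd-nil  : ∀ {x} → PalDecomp a x []
  pd-cons : ∀ {x l ls} → 0 < l → Palindrome (factor a x l) →
            PalDecomp a (x + l) ls → PalDecomp a x (l ∷ ls)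

IsPalDecompPrefix : {A : Set} → (ℕ → A) → ℕ → List ℕ → Set
IsPalDecompPrefix a k ls = PalDecomp a 0 ls × sum ls ≡ k

IsOptimalPalDecompPrefix : {A : Set} → (ℕ → A) → ℕ → List ℕ → Set
IsOptimalPalDecompPrefix a k ls =
  IsPalDecompPrefix a k ls ×
  ((ms : List ℕ) → IsPalDecompPrefix a k ms → length ls ≤ length ms)

data AllFactors (P : ℕ → ℕ → Set) : ℕ → List ℕ → Set where
  af-nil  : ∀ {x} → AllFactors P x []
  af-cons : ∀ {x l ls} → P x l → AllFactors P (x + l) ls → AllFactors P x (l ∷ ls)

EmbeddedCenter : ℕ → ℕ → ℕ → ℕ → Set
EmbeddedCenter x y X Y = X ≤ x × x + y ≤ X + Y × x ∸ X ≡ (X + Y) ∸ (x + y)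

module Submission where

-- A sequence a in C is made of blocks u v v u with u ≠ v, and collapsing every block to
-- the letter (u, v) gives again a sequence of C, over the alphabet A × A; palindromes made
-- of whole blocks correspond to palindromes of the collapsed sequence, and the other
-- palindromes are short or sit at constrained positions.  Let pl be defined by
-- pl(4q) = pl(q), pl(4q+1) = pl(q)+1, pl(4q+2) = 2 + min(pl(q), pl(q+1)), pl(4q+3) = pl(q+1)+1.
-- Induction through the collapse shows both halves of "pl(k) is the palindromic length of
-- w_a(0,k)": appending a palindrome w_a(s,l) to w_a(0,s) raises pl by at most one, and
-- scaling a decomposition of a collapsed prefix and adjusting its last factor builds a
-- decomposition of w_a(0,k) into pl(k) palindromes, none of length 3, whose even ones are
-- centred in palindromes w_a(4z,4r) obtained from factors of the collapsed decomposition.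

open import Defs
open import Data.Empty using (⊥; ⊥-elim)
open import Data.List using (List; []; _∷_; _++_; reverse; applyUpTo; applyDownFrom; length)
open import Data.List.Properties using (map-upTo; reverse-applyUpTo; ∷-injective; length-++)
open import Data.List.Relation.Unary.All as All using (All; []; _∷_)
open import Data.List.Relation.Unary.All.Properties using (++⁺; map⁺)
open import Data.Nat
open import Data.Nat.DivMod using (_%_; [m+kn]%n≡m%n)
open import Data.Nat.Divisibility using (_∣_; ∣1⇒≡1)
open import Data.Nat.Induction using (<-wellFounded)
open import Data.Nat.ListAction using (sum)
open import Data.Nat.ListAction.Properties using (sum-++)
open import Data.Nat.Properties
open import Data.Nat.Tactic.RingSolver using (solve-∀)
open import Data.Product
open import Data.Product.Function.NonDependent.Propositional using (_×-↔_)
open import Function.Base using (_∘_)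
open import Function.Bundles using (Inverse; Injection; _↔_)
open import Function.Properties.Inverse using (↔⇒↣)
open import Induction.WellFounded using (Acc; acc)
open import Relation.Binary.PropositionalEquality
open import Relation.Nullary using (yes; no; contradiction)

data Mod4 : ℕ → Set where
  4q   : ∀ q → Mod4 (q * 4)
  4q+1 : ∀ q → Mod4 (1 + q * 4)
  4q+2 : ∀ q → Mod4 (2 + q * 4)
  4q+3 : ∀ q → Mod4 (3 + q * 4)

mod4-suc : ∀ {n} → Mod4 n → Mod4 (suc n)
mod4-suc (4q q)   = 4q+1 q
mod4-suc (4q+1 q) = 4q+2 q
mod4-suc (4q+2 q) = 4q+3 q
mod4-suc (4q+3 q) = 4q (suc q)

mod4 : ∀ n → Mod4 n
mod4 zero    = 4q 0
mod4 (suc n) = mod4-suc (mod4 n)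

mod4-4q : ∀ q → mod4 (q * 4) ≡ 4q q
mod4-4q zero    = refl
mod4-4q (suc q) = cong (λ v → mod4-suc (mod4-suc (mod4-suc (mod4-suc v)))) (mod4-4q q)

mod4-4q+1 : ∀ q → mod4 (1 + q * 4) ≡ 4q+1 q
mod4-4q+1 q = cong mod4-suc (mod4-4q q)

mod4-4q+2 : ∀ q → mod4 (2 + q * 4) ≡ 4q+2 q
mod4-4q+2 q = cong mod4-suc (mod4-4q+1 q)

mod4-4q+3 : ∀ q → mod4 (3 + q * 4) ≡ 4q+3 q
mod4-4q+3 q = cong mod4-suc (mod4-4q+2 q)

r+q*4≢s+p*4 : ∀ r s q p → r % 4 ≢ s % 4 → r + q * 4 ≢ s + p * 4
r+q*4≢s+p*4 r s q p r≢s e =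
  r≢s (trans (sym ([m+kn]%n≡m%n r q 4)) (trans (cong (_% 4) e) ([m+kn]%n≡m%n s p 4)))

q≤r+q*4 : ∀ r q → q ≤ r + q * 4
q≤r+q*4 r q = ≤-trans (m≤m*n q 4) (m≤n+m (q * 4) r)

-- The palindromic length of prefixes

-- The fuel makes the recursion on n / 4 structural; any fuel ≥ n gives the same value.
palLenStep : ∀ {n} → Mod4 n → (ℕ → ℕ) → ℕ
palLenStep (4q q)   pl = pl q
palLenStep (4q+1 q) pl = suc (pl q)
palLenStep (4q+2 q) pl = 2 + (pl q ⊓ pl (suc q))
palLenStep (4q+3 q) pl = suc (pl (suc q))

palLenFuel : ℕ → ℕ → ℕ
palLenFuel zero    n = 0
palLenFuel (suc f) n = palLenStep (mod4 n) (palLenFuel f)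

palLen : ℕ → ℕ
palLen n = palLenFuel n n

palLenFuel-suc : ∀ f {n} → n ≤ f → palLenFuel (suc f) n ≡ palLenFuel f n
palLenFuel-suc zero    z≤n = refl
palLenFuel-suc (suc f) {n} n≤1+f = step (mod4 n) n≤1+f
  where
  step : ∀ {n} (v : Mod4 n) → n ≤ suc f → palLenStep v (palLenFuel (suc f)) ≡ palLenStep v (palLenFuel f)
  step (4q zero)    _         = palLenFuel-suc f z≤n
  step (4q (suc q)) (s≤s le)  = palLenFuel-suc f (≤-trans (s≤s (q≤r+q*4 2 q)) le)
  step (4q+1 q)     (s≤s le)  = cong suc (palLenFuel-suc f (≤-trans (q≤r+q*4 0 q) le))
  step (4q+2 q)     (s≤s le)  =
    cong₂ (λ x y → 2 + (x ⊓ y)) (palLenFuel-suc f (≤-trans (q≤r+q*4 1 q) le))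
                                (palLenFuel-suc f (≤-trans (s≤s (q≤r+q*4 0 q)) le))
  step (4q+3 q)     (s≤s le)  = cong suc (palLenFuel-suc f (≤-trans (s≤s (q≤r+q*4 1 q)) le))

palLenFuel-stable : ∀ {n f} → n ≤′ f → palLenFuel f n ≡ palLen n
palLenFuel-stable ≤′-refl = refl
palLenFuel-stable (≤′-step {f} n≤′f) = trans (palLenFuel-suc f (≤′⇒≤ n≤′f)) (palLenFuel-stable n≤′f)

palLen-4q : ∀ q → palLen (q * 4) ≡ palLen q
palLen-4q zero = refl
palLen-4q (suc q) rewrite mod4-4q (suc q) = palLenFuel-stable (≤⇒≤′ (s≤s (q≤r+q*4 2 q)))

palLen-4q+1 : ∀ q → palLen (1 + q * 4) ≡ suc (palLen q)
palLen-4q+1 q rewrite mod4-4q+1 q = cong suc (palLenFuel-stable (≤⇒≤′ (q≤r+q*4 0 q)))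

palLen-4q+2 : ∀ q → palLen (2 + q * 4) ≡ 2 + (palLen q ⊓ palLen (suc q))
palLen-4q+2 q rewrite mod4-4q+2 q =
  cong₂ (λ x y → 2 + (x ⊓ y)) (palLenFuel-stable (≤⇒≤′ (q≤r+q*4 1 q)))
                              (palLenFuel-stable (≤⇒≤′ (s≤s (q≤r+q*4 0 q))))

palLen-4q+3 : ∀ q → palLen (3 + q * 4) ≡ suc (palLen (suc q))
palLen-4q+3 q rewrite mod4-4q+3 q = cong suc (palLenFuel-stable (≤⇒≤′ (s≤s (q≤r+q*4 1 q))))

module _ {A : Set} where

  segment : (ℕ → A) → ℕ → ℕ → List A
  segment a x zero    = []
  segment a x (suc y) = a x ∷ segment a (suc x) y

  applyUpTo≡segment : (a g : ℕ → A) (x y : ℕ) → (∀ i → g i ≡ a (x + i)) → applyUpTo g y ≡ segment a x y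
  applyUpTo≡segment a g x zero    g≗a = refl
  applyUpTo≡segment a g x (suc y) g≗a =
    cong₂ _∷_ (trans (g≗a 0) (cong a (+-identityʳ x)))
              (applyUpTo≡segment a (g ∘ suc) (suc x) y (λ i → trans (g≗a (suc i)) (cong a (+-suc x i))))

  factor≡segment : (a : ℕ → A) (x y : ℕ) → factor a x y ≡ segment a x y
  factor≡segment a x y = trans (map-upTo (λ i → a (x + i)) y) (applyUpTo≡segment a _ x y (λ i → refl))

  PalAt : (ℕ → A) → ℕ → ℕ → Set
  PalAt a s l = ∀ i j → suc (i + j) ≡ l → a (s + i) ≡ a (s + j)

  private
    applyDownFrom≡applyUpTo : (g : ℕ → A) (l : ℕ) → applyDownFrom g l ≡ applyUpTo (λ i → g (l ∸ suc i)) l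
    applyDownFrom≡applyUpTo g zero    = refl
    applyDownFrom≡applyUpTo g (suc l) = cong (g l ∷_) (applyDownFrom≡applyUpTo g l)

    applyUpTo-injective : (g h : ℕ → A) (l : ℕ) → applyUpTo g l ≡ applyUpTo h l → ∀ i → i < l → g i ≡ h i
    applyUpTo-injective g h (suc l) eq zero    _        = proj₁ (∷-injective eq)
    applyUpTo-injective g h (suc l) eq (suc i) (s≤s lt) =
      applyUpTo-injective (λ k → g (suc k)) (λ k → h (suc k)) l (proj₂ (∷-injective eq)) i lt

    applyUpTo-cong : (g h : ℕ → A) (l : ℕ) → (∀ i → i < l → g i ≡ h i) → applyUpTo g l ≡ applyUpTo h l
    applyUpTo-cong g h zero    _   = refl
    applyUpTo-cong g h (suc l) g≗h =
      cong₂ _∷_ (g≗h 0 (s≤s z≤n)) (applyUpTo-cong (λ k → g (suc k)) (λ k → h (suc k)) l (λ i lt → g≗h (suc i) (s≤s lt)))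

    reverse-factor : (a : ℕ → A) (s l : ℕ) → reverse (factor a s l) ≡ applyUpTo (λ i → a (s + (l ∸ suc i))) l
    reverse-factor a s l = trans (cong reverse (map-upTo (λ i → a (s + i)) l))
                            (trans (reverse-applyUpTo _ l) (applyDownFrom≡applyUpTo (λ i → a (s + i)) l))

  Palindrome⇒PalAt : (a : ℕ → A) (s l : ℕ) → Palindrome (factor a s l) → PalAt a s l
  Palindrome⇒PalAt a s l pal i j i+j+1≡l =
    trans (sym (applyUpTo-injective _ _ l mirrored i i<l)) (cong (λ k → a (s + k)) l∸i+1≡j)
    where
    mirrored : applyUpTo (λ i → a (s + (l ∸ suc i))) l ≡ applyUpTo (λ i → a (s + i)) l
    mirrored = trans (sym (reverse-factor a s l)) (trans pal (map-upTo (λ i → a (s + i)) l))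
    i<l : i < l
    i<l = subst (i <_) i+j+1≡l (s≤s (m≤m+n i j))
    l∸i+1≡j : l ∸ suc i ≡ j
    l∸i+1≡j = trans (cong (_∸ suc i) (sym i+j+1≡l)) (m+n∸m≡n (suc i) j)

  PalAt⇒Palindrome : (a : ℕ → A) (s l : ℕ) → PalAt a s l → Palindrome (factor a s l)
  PalAt⇒Palindrome a s l pal =
    trans (reverse-factor a s l)
          (trans (applyUpTo-cong _ _ l (λ i i<l → sym (pal i (l ∸ suc i) (m+[n∸m]≡n i<l))))
                 (sym (map-upTo (λ i → a (s + i)) l)))

  PalAt-1 : (a : ℕ → A) (s : ℕ) → PalAt a s 1
  PalAt-1 a s zero zero refl = refl

  PalAt-inner : (a : ℕ → A) (s l : ℕ) → PalAt a s (2 + l) → PalAt a (suc s) l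
  PalAt-inner a s l pal i j i+j+1≡l =
    trans (cong a (sym (+-suc s i)))
          (trans (pal (suc i) (suc j) (cong (2 +_) (trans (+-suc i j) i+j+1≡l))) (cong a (+-suc s j)))

  PalAt-extend : (a : ℕ → A) {s l : ℕ} → PalAt a (suc s) l → a s ≡ a (s + suc l) → PalAt a s (2 + l)
  PalAt-extend a {s} {l} pal ends zero j eq =
    trans (cong a (+-identityʳ s)) (trans ends (cong (λ k → a (s + k)) (sym (suc-injective eq))))
  PalAt-extend a {s} {l} pal ends (suc i) zero eq =
    sym (trans (cong a (+-identityʳ s)) (trans ends (cong (λ k → a (s + k))
      (sym (trans (sym (+-identityʳ (suc i))) (suc-injective eq))))))
  PalAt-extend a {s} {l} pal ends (suc i) (suc j) eq =
    trans (cong a (+-suc s i))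
          (trans (pal i j (suc-injective (trans (sym (+-suc (suc i) j)) (suc-injective eq)))) (cong a (sym (+-suc s j))))

-- The block structure of sequences in C

record Blocks {A : Set} (a : ℕ → A) : Set where
  field
    first≢second : ∀ q → a (q * 4) ≢ a (1 + q * 4)
    third≡second : ∀ q → a (2 + q * 4) ≡ a (1 + q * 4)
    fourth≡first : ∀ q → a (3 + q * 4) ≡ a (q * 4)

collapse : {A : Set} → (ℕ → A) → ℕ → A × A
collapse a q = a (q * 4) , a (1 + q * 4)

module _ {A : Set} where

  expand : List (A × A) → List A
  expand []            = []
  expand ((u , v) ∷ p) = u ∷ v ∷ v ∷ u ∷ expand p

  compress : List A → List (A × A)
  compress (u ∷ v ∷ _ ∷ _ ∷ w) = (u , v) ∷ compress w
  compress _                   = []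

  compress-expand : ∀ p → compress (expand p) ≡ p
  compress-expand []            = refl
  compress-expand ((u , v) ∷ p) = cong ((u , v) ∷_) (compress-expand p)

  expand-++ : ∀ p q → expand (p ++ q) ≡ expand p ++ expand q
  expand-++ []            q = refl
  expand-++ ((u , v) ∷ p) q = cong (λ w → u ∷ v ∷ v ∷ u ∷ w) (expand-++ p q)

  expand-img : ∀ (g : A ↔ A) p → expand (img (g ×-↔ g) p) ≡ img g (expand p)
  expand-img g []            = refl
  expand-img g ((u , v) ∷ p) = cong (λ w → _ ∷ _ ∷ _ ∷ _ ∷ w) (expand-img g p)

  segment-collapse : (a : ℕ → A) → ∀ s m → segment (collapse a) s m ≡ compress (segment a (s * 4) (m * 4))
  segment-collapse a s zero    = refl
  segment-collapse a s (suc m) = cong (collapse a s ∷_) (segment-collapse a (suc s) m)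

  -- w_{n+1} over A is w_n over A × A, for the initial letter (x, f₀ x) and the
  -- bijections f_{n+1} acting on both components, with every letter u v read as u v v u.
  module Collapse (x : A) (f : ℕ → A ↔ A) where
    x₂ : A × A
    x₂ = x , Inverse.to (f 0) x

    f₂ : ℕ → (A × A) ↔ (A × A)
    f₂ n = f (suc n) ×-↔ f (suc n)

    wSeq-suc : ∀ n → wSeq x f (suc n) ≡ expand (wSeq x₂ f₂ n)
    wSeq-suc zero    = refl
    wSeq-suc (suc n) = sym (begin
        expand (u ++ v ++ v ++ u)
          ≡⟨ expand-++ u _ ⟩
        expand u ++ expand (v ++ v ++ u)
          ≡⟨ cong (expand u ++_) (trans (expand-++ v _) (cong (expand v ++_) (expand-++ v u))) ⟩
        expand u ++ expand v ++ expand v ++ expand u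
          ≡⟨ cong (λ w → expand u ++ w ++ w ++ expand u) (expand-img (f (suc n)) u) ⟩
        expand u ++ img (f (suc n)) (expand u) ++ img (f (suc n)) (expand u) ++ expand u
          ≡⟨ cong (λ w → w ++ img (f (suc n)) w ++ img (f (suc n)) w ++ w) (sym (wSeq-suc n)) ⟩
        wSeq x f (suc (suc n)) ∎)
      where
      open ≡-Reasoning
      u = wSeq x₂ f₂ n
      v = img (f₂ n) u

    wSeq-distinct : img (f 0) (x ∷ []) ≢ x ∷ [] → ∀ n → All (λ uv → proj₁ uv ≢ proj₂ uv) (wSeq x₂ f₂ n)
    wSeq-distinct f₀x≢x zero    = (λ e → f₀x≢x (cong (_∷ []) (sym e))) ∷ []
    wSeq-distinct f₀x≢x (suc n) = ++⁺ ih (++⁺ image (++⁺ image ih))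
      where
      ih = wSeq-distinct f₀x≢x n
      image : All (λ uv → proj₁ uv ≢ proj₂ uv) (img (f₂ n) (wSeq x₂ f₂ n))
      image = map⁺ (All.map (λ u≢v e → u≢v (Injection.injective (↔⇒↣ (f (suc n))) e)) ih)

    prefix-expand : (a : ℕ → A) → (∀ n → factor a 0 (4 ^ n) ≡ wSeq x f n) →
                    ∀ n → segment a 0 (4 ^ n * 4) ≡ expand (wSeq x₂ f₂ n)
    prefix-expand a prefix n = trans (cong (segment a 0) (*-comm (4 ^ n) 4))
      (trans (sym (factor≡segment a 0 (4 ^ suc n))) (trans (prefix (suc n)) (wSeq-suc n)))

  BlockAt : (ℕ → A) → ℕ → Set
  BlockAt a q = (a (2 + q * 4) ≡ a (1 + q * 4)) × (a (3 + q * 4) ≡ a (q * 4)) × (a (q * 4) ≢ a (1 + q * 4))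

  expand-BlockAt : (a : ℕ → A) → ∀ m s p → segment a (s * 4) (m * 4) ≡ expand p →
                   All (λ uv → proj₁ uv ≢ proj₂ uv) p → ∀ q → q < m → BlockAt a (q + s)
  expand-BlockAt a (suc m) s ((u , v) ∷ p) eq (u≢v ∷ _) zero _ =
    trans a₂ (sym a₁) , trans a₃ (sym a₀) , λ e → u≢v (trans (sym a₀) (trans e a₁))
    where
    a₀ = proj₁ (∷-injective eq)
    a₁ = proj₁ (∷-injective (proj₂ (∷-injective eq)))
    a₂ = proj₁ (∷-injective (proj₂ (∷-injective (proj₂ (∷-injective eq)))))
    a₃ = proj₁ (∷-injective (proj₂ (∷-injective (proj₂ (∷-injective (proj₂ (∷-injective eq)))))))
  expand-BlockAt a (suc m) s ((u , v) ∷ p) eq (_ ∷ distinct) (suc q) (s≤s q<m) =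
    subst (BlockAt a) (+-suc q s) (expand-BlockAt a m (suc s) p rest distinct q q<m)
    where
    rest = proj₂ (∷-injective (proj₂ (∷-injective (proj₂ (∷-injective (proj₂ (∷-injective eq)))))))

n<4^n : ∀ n → n < 4 ^ n
n<4^n zero    = s≤s z≤n
n<4^n (suc n) = ≤-trans (+-mono-≤ {1} {4 ^ n} (≤-trans (s≤s z≤n) ih) ih) (+-monoʳ-≤ (4 ^ n) (m≤m+n (4 ^ n) _))
  where ih = n<4^n n

InC⇒Blocks : {A : Set} (a : ℕ → A) → InC a → Blocks a
InC⇒Blocks a (x , f , f≢id , prefix) = record
  { first≢second = λ q → proj₂ (proj₂ (block q))
  ; third≡second = λ q → proj₁ (block q)
  ; fourth≡first = λ q → proj₁ (proj₂ (block q))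
  }
  where
  open Collapse x f
  block : ∀ q → BlockAt a q
  block q = subst (BlockAt a) (+-identityʳ q)
    (expand-BlockAt a (4 ^ q) 0 _ (prefix-expand a prefix q) (wSeq-distinct (f≢id 0) q) q (n<4^n q))

InC-collapse : {A : Set} (a : ℕ → A) → InC a → InC (collapse a)
InC-collapse a (x , f , f≢id , prefix) = x₂ , f₂ , f₂≢id , prefix₂
  where
  open Collapse x f
  f₂≢id : ∀ n → img (f₂ n) (wSeq x₂ f₂ n) ≢ wSeq x₂ f₂ n
  f₂≢id n e = f≢id (suc n) (trans (cong (img (f (suc n))) (wSeq-suc n))
               (trans (sym (expand-img (f (suc n)) _)) (trans (cong expand e) (sym (wSeq-suc n)))))
  prefix₂ : ∀ n → factor (collapse a) 0 (4 ^ n) ≡ wSeq x₂ f₂ n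
  prefix₂ n = trans (factor≡segment (collapse a) 0 (4 ^ n)) (trans (segment-collapse a 0 (4 ^ n))
                (trans (cong compress (prefix-expand a prefix n)) (compress-expand _)))

-- Palindromes in a sequence with block structure

module BlockPalindromes {A : Set} (a : ℕ → A) (blocks : Blocks a) where
  open Blocks blocks

  third≢fourth : ∀ q → a (2 + q * 4) ≢ a (3 + q * 4)
  third≢fourth q e = first≢second q (trans (sym (fourth≡first q)) (trans (sym e) (third≡second q)))

  a[2u]≢a[2u+1] : ∀ u → a (u + u) ≢ a (suc (u + u))
  a[2u]≢a[2u+1] u = go (mod4 u)
    where
    go : ∀ {u} → Mod4 u → a (u + u) ≢ a (suc (u + u))
    go (4q q) = first≢second (q * 2) ∘ subst (λ t → a t ≡ a (suc t)) (e q)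
      where e : ∀ q → q * 4 + q * 4 ≡ (q * 2) * 4
            e = solve-∀
    go (4q+1 q) = third≢fourth (q * 2) ∘ subst (λ t → a t ≡ a (suc t)) (e q)
      where e : ∀ q → (1 + q * 4) + (1 + q * 4) ≡ 2 + (q * 2) * 4
            e = solve-∀
    go (4q+2 q) = first≢second (suc (q * 2)) ∘ subst (λ t → a t ≡ a (suc t)) (e q)
      where e : ∀ q → (2 + q * 4) + (2 + q * 4) ≡ suc (q * 2) * 4
            e = solve-∀
    go (4q+3 q) = third≢fourth (suc (q * 2)) ∘ subst (λ t → a t ≡ a (suc t)) (e q)
      where e : ∀ q → (3 + q * 4) + (3 + q * 4) ≡ 2 + suc (q * 2) * 4
            e = solve-∀

  no-pal5 : ∀ t → a (1 + t) ≡ a (3 + t) → a t ≡ a (4 + t) → ⊥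
  no-pal5 t = go (mod4 t)
    where
    go : ∀ {t} → Mod4 t → a (1 + t) ≡ a (3 + t) → a t ≡ a (4 + t) → ⊥
    go (4q q)   e₁ e₀ = first≢second q (sym (trans e₁ (fourth≡first q)))
    go (4q+1 q) e₁ e₀ = first≢second (suc q) (trans (sym e₁) (trans (third≡second q) e₀))
    go (4q+2 q) e₁ e₀ = third≢fourth q (trans (trans e₀ (third≡second (suc q))) (sym e₁))
    go (4q+3 q) e₁ e₀ = first≢second (suc q) (trans e₁ (third≡second (suc q)))

  PalAt-at : ∀ {s l} → PalAt a s l → ∀ i j {p q} → suc (i + j) ≡ l → s + i ≡ p → s + j ≡ q → a p ≡ a q
  PalAt-at pal i j i+j+1≡l refl refl = pal i j i+j+1≡l

  ¬PalAt-centred-after-even : ∀ s l i u → PalAt a s l → suc (i + suc i) ≡ l → s + i ≡ u + u → ⊥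
  ¬PalAt-centred-after-even s l i u pal e₁ e₂ =
    a[2u]≢a[2u+1] u (PalAt-at pal i (suc i) e₁ e₂ (trans (+-suc s i) (cong suc e₂)))

  ¬PalAt-4S-4L+2 : ∀ S L → PalAt a (S * 4) (2 + L * 4) → ⊥
  ¬PalAt-4S-4L+2 S L pal = ¬PalAt-centred-after-even _ _ (L * 2) (S * 2 + L) pal (e L) (e′ S L)
    where e : ∀ L → suc (L * 2 + suc (L * 2)) ≡ 2 + L * 4
          e = solve-∀
          e′ : ∀ S L → S * 4 + L * 2 ≡ (S * 2 + L) + (S * 2 + L)
          e′ = solve-∀

  ¬PalAt-4S+2-4L+2 : ∀ S L → PalAt a (2 + S * 4) (2 + L * 4) → ⊥
  ¬PalAt-4S+2-4L+2 S L pal = ¬PalAt-centred-after-even _ _ (L * 2) (1 + S * 2 + L) pal (e L) (e′ S L)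
    where e : ∀ L → suc (L * 2 + suc (L * 2)) ≡ 2 + L * 4
          e = solve-∀
          e′ : ∀ S L → (2 + S * 4) + L * 2 ≡ (1 + S * 2 + L) + (1 + S * 2 + L)
          e′ = solve-∀

  ¬PalAt-4S+1-4L+4 : ∀ S L → PalAt a (1 + S * 4) (suc L * 4) → ⊥
  ¬PalAt-4S+1-4L+4 S L pal = ¬PalAt-centred-after-even _ _ (1 + L * 2) (1 + S * 2 + L) pal (e L) (e′ S L)
    where e : ∀ L → suc ((1 + L * 2) + suc (1 + L * 2)) ≡ suc L * 4
          e = solve-∀
          e′ : ∀ S L → (1 + S * 4) + (1 + L * 2) ≡ (1 + S * 2 + L) + (1 + S * 2 + L)
          e′ = solve-∀

  ¬PalAt-4S+3-4L+4 : ∀ S L → PalAt a (3 + S * 4) (suc L * 4) → ⊥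
  ¬PalAt-4S+3-4L+4 S L pal = ¬PalAt-centred-after-even _ _ (1 + L * 2) (2 + S * 2 + L) pal (e L) (e′ S L)
    where e : ∀ L → suc ((1 + L * 2) + suc (1 + L * 2)) ≡ suc L * 4
          e = solve-∀
          e′ : ∀ S L → (3 + S * 4) + (1 + L * 2) ≡ (2 + S * 2 + L) + (2 + S * 2 + L)
          e′ = solve-∀

  ¬PalAt-5+4L : ∀ s L → PalAt a s (5 + L * 4) → ⊥
  ¬PalAt-5+4L s L pal = no-pal5 (s + L * 2)
      (PalAt-at pal (1 + L * 2) (3 + L * 2) (e₁ L) (e₂ s L) (e₃ s L))
      (PalAt-at pal (L * 2) (4 + L * 2) (e₄ L) refl (e₅ s L))
    where
    e₁ : ∀ L → suc ((1 + L * 2) + (3 + L * 2)) ≡ 5 + L * 4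
    e₁ = solve-∀
    e₂ : ∀ s L → s + (1 + L * 2) ≡ 1 + (s + L * 2)
    e₂ = solve-∀
    e₃ : ∀ s L → s + (3 + L * 2) ≡ 3 + (s + L * 2)
    e₃ = solve-∀
    e₄ : ∀ L → suc (L * 2 + (4 + L * 2)) ≡ 5 + L * 4
    e₄ = solve-∀
    e₅ : ∀ s L → s + (4 + L * 2) ≡ 4 + (s + L * 2)
    e₅ = solve-∀

  ¬PalAt-7+4L : ∀ s L → PalAt a s (7 + L * 4) → ⊥
  ¬PalAt-7+4L s L pal = ¬PalAt-5+4L (suc s) L (PalAt-inner a s (5 + L * 4) pal)

  ¬PalAt-4S-3 : ∀ S → PalAt a (S * 4) 3 → ⊥
  ¬PalAt-4S-3 S pal =
    first≢second S (trans (PalAt-at pal 0 2 refl (+-identityʳ _) (+-comm (S * 4) 2)) (third≡second S))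

  ¬PalAt-4S+1-3 : ∀ S → PalAt a (1 + S * 4) 3 → ⊥
  ¬PalAt-4S+1-3 S pal =
    first≢second S (sym (trans (PalAt-at pal 0 2 refl (+-identityʳ _) (e S)) (fourth≡first S)))
    where e : ∀ S → (1 + S * 4) + 2 ≡ 3 + S * 4
          e = solve-∀

  private
    S*4+[r+I*4] : ∀ S r I → S * 4 + (r + I * 4) ≡ r + (S + I) * 4
    S*4+[r+I*4] = solve-∀

  PalAt⇒PalAt-collapse : ∀ S L → PalAt a (S * 4) (L * 4) → PalAt (collapse a) S L
  PalAt⇒PalAt-collapse S L pal I J I+J+1≡L = cong₂ _,_ firsts seconds
    where
    e₀₃ : ∀ I J → suc (I * 4 + (3 + J * 4)) ≡ suc (I + J) * 4
    e₀₃ = solve-∀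
    e₁₂ : ∀ I J → suc ((1 + I * 4) + (2 + J * 4)) ≡ suc (I + J) * 4
    e₁₂ = solve-∀
    firsts : a ((S + I) * 4) ≡ a ((S + J) * 4)
    firsts = trans (PalAt-at pal (I * 4) (3 + J * 4) (trans (e₀₃ I J) (cong (_* 4) I+J+1≡L))
                     (S*4+[r+I*4] S 0 I) (S*4+[r+I*4] S 3 J))
                   (fourth≡first (S + J))
    seconds : a (1 + (S + I) * 4) ≡ a (1 + (S + J) * 4)
    seconds = trans (PalAt-at pal (1 + I * 4) (2 + J * 4) (trans (e₁₂ I J) (cong (_* 4) I+J+1≡L))
                      (S*4+[r+I*4] S 1 I) (S*4+[r+I*4] S 2 J))
                    (third≡second (S + J))

  PalAt-collapse⇒PalAt : ∀ S L → PalAt (collapse a) S L → PalAt a (S * 4) (L * 4)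
  PalAt-collapse⇒PalAt S L pal i j i+j+1≡4L = go (mod4 i) (mod4 j) i+j+1≡4L
    where
    shift : ∀ r s I J → suc ((r + I * 4) + (s + J * 4)) ≡ L * 4 → suc (r + s) + (I + J) * 4 ≡ L * 4
    shift r s I J = trans (sym (e r s I J))
      where e : ∀ r s I J → suc ((r + I * 4) + (s + J * 4)) ≡ suc (r + s) + (I + J) * 4
            e = solve-∀
    misaligned : ∀ r s I J → suc (r + s) % 4 ≢ 0 → suc ((r + I * 4) + (s + J * 4)) ≡ L * 4 → ⊥
    misaligned r s I J r+s+1≢0 eq = r+q*4≢s+p*4 (suc (r + s)) 0 (I + J) L r+s+1≢0 (shift r s I J eq)
    mirror : ∀ I J → suc (I + J) * 4 ≡ L * 4 → collapse a (S + I) ≡ collapse a (S + J)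
    mirror I J eq = pal I J (*-cancelʳ-≡ (suc (I + J)) L 4 eq)
    at : ∀ r I → a (S * 4 + (r + I * 4)) ≡ a (r + (S + I) * 4)
    at r I = cong a (S*4+[r+I*4] S r I)
    go : ∀ {i j} → Mod4 i → Mod4 j → suc (i + j) ≡ L * 4 → a (S * 4 + i) ≡ a (S * 4 + j)
    go (4q I)   (4q+3 J) eq = trans (at 0 I) (trans (cong proj₁ (mirror I J (shift 0 3 I J eq)))
                                (trans (sym (fourth≡first (S + J))) (sym (at 3 J))))
    go (4q+1 I) (4q+2 J) eq = trans (at 1 I) (trans (cong proj₂ (mirror I J (shift 1 2 I J eq)))
                                (trans (sym (third≡second (S + J))) (sym (at 2 J))))
    go (4q+2 I) (4q+1 J) eq = trans (at 2 I) (trans (third≡second (S + I))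
                                (trans (cong proj₂ (mirror I J (shift 2 1 I J eq))) (sym (at 1 J))))
    go (4q+3 I) (4q J)   eq = trans (at 3 I) (trans (fourth≡first (S + I))
                                (trans (cong proj₁ (mirror I J (shift 3 0 I J eq))) (sym (at 0 J))))
    go (4q I)   (4q J)   eq = ⊥-elim (misaligned 0 0 I J (λ ()) eq)
    go (4q I)   (4q+1 J) eq = ⊥-elim (misaligned 0 1 I J (λ ()) eq)
    go (4q I)   (4q+2 J) eq = ⊥-elim (misaligned 0 2 I J (λ ()) eq)
    go (4q+1 I) (4q J)   eq = ⊥-elim (misaligned 1 0 I J (λ ()) eq)
    go (4q+1 I) (4q+1 J) eq = ⊥-elim (misaligned 1 1 I J (λ ()) eq)
    go (4q+1 I) (4q+3 J) eq = ⊥-elim (misaligned 1 3 I J (λ ()) eq)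
    go (4q+2 I) (4q J)   eq = ⊥-elim (misaligned 2 0 I J (λ ()) eq)
    go (4q+2 I) (4q+2 J) eq = ⊥-elim (misaligned 2 2 I J (λ ()) eq)
    go (4q+2 I) (4q+3 J) eq = ⊥-elim (misaligned 2 3 I J (λ ()) eq)
    go (4q+3 I) (4q+1 J) eq = ⊥-elim (misaligned 3 1 I J (λ ()) eq)
    go (4q+3 I) (4q+2 J) eq = ⊥-elim (misaligned 3 2 I J (λ ()) eq)
    go (4q+3 I) (4q+3 J) eq = ⊥-elim (misaligned 3 3 I J (λ ()) eq)

-- Appending a palindrome increases the palindromic length by at most one

PalLenBound : {B : Set} → (ℕ → B) → ℕ → ℕ → Set
PalLenBound b s l = PalAt b s l → palLen (s + l) ≤ suc (palLen s)

PalLenBoundBelow : {B : Set} → (ℕ → B) → ℕ → Set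
PalLenBoundBelow b n = ∀ s l → s + l < n → PalLenBound b s l

<-from-≡ : ∀ {m n} d → n ≡ suc (m + d) → m < n
<-from-≡ {m} d refl = s≤s (m≤m+n m d)

m≤2+[n⊓m] : ∀ {m n} → m ≤ suc n → m ≤ 2 + (n ⊓ m)
m≤2+[n⊓m] {m} {n} m≤1+n = subst (m ≤_) (sym (+-distribˡ-⊓ 2 n m)) (⊓-glb (m≤n⇒m≤1+n m≤1+n) (m≤n+m m 2))

⊓-≤-suc : ∀ {x y u v} → x ≤ suc v → y ≤ suc u → x ⊓ y ≤ suc (u ⊓ v)
⊓-≤-suc {u = u} {v} x≤1+v y≤1+u = ≤-trans (⊓-mono-≤ x≤1+v y≤1+u) (s≤s (≤-reflexive (⊓-comm v u)))

palLen-+0 : ∀ s → palLen (s + 0) ≤ suc (palLen s)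
palLen-+0 s = subst (λ n → palLen n ≤ suc (palLen s)) (sym (+-identityʳ s)) (n≤1+n (palLen s))

module PalLenCases {A : Set} (a : ℕ → A) (blocks : Blocks a) where
  open Blocks blocks
  open BlockPalindromes a blocks
  open ≤-Reasoning

  palLen-4S+4L : ∀ S L → PalLenBoundBelow (collapse a) (S * 4 + suc L * 4) → PalLenBound a (S * 4) (suc L * 4)
  palLen-4S+4L S L ih pal = begin
      palLen (S * 4 + suc L * 4) ≡⟨ cong palLen (e S L) ⟩
      palLen ((S + suc L) * 4)   ≡⟨ palLen-4q (S + suc L) ⟩
      palLen (S + suc L)         ≤⟨ ih S (suc L) (<-from-≡ (S * 3 + L * 3 + 2) (e′ S L)) (PalAt⇒PalAt-collapse S (suc L) pal) ⟩
      suc (palLen S)             ≡⟨ cong suc (palLen-4q S) ⟨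
      suc (palLen (S * 4))       ∎
    where
    e : ∀ S L → S * 4 + suc L * 4 ≡ (S + suc L) * 4
    e = solve-∀
    e′ : ∀ S L → S * 4 + suc L * 4 ≡ suc ((S + suc L) + (S * 3 + L * 3 + 2))
    e′ = solve-∀

  palLen-4S+1 : ∀ S → palLen (S * 4 + 1) ≤ suc (palLen (S * 4))
  palLen-4S+1 S = ≤-reflexive (begin-equality
    palLen (S * 4 + 1)   ≡⟨ cong palLen (+-comm (S * 4) 1) ⟩
    palLen (1 + S * 4)   ≡⟨ palLen-4q+1 S ⟩
    suc (palLen S)       ≡⟨ cong suc (palLen-4q S) ⟨
    suc (palLen (S * 4)) ∎)

  palLen-4S+1+1 : ∀ S → palLen ((1 + S * 4) + 1) ≤ suc (palLen (1 + S * 4))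
  palLen-4S+1+1 S = begin
    palLen ((1 + S * 4) + 1)            ≡⟨ cong (palLen ∘ suc) (+-comm (S * 4) 1) ⟩
    palLen (2 + S * 4)                  ≡⟨ palLen-4q+2 S ⟩
    2 + (palLen S ⊓ palLen (suc S))     ≤⟨ +-monoʳ-≤ 2 (m⊓n≤m _ _) ⟩
    2 + palLen S                        ≡⟨ cong suc (palLen-4q+1 S) ⟨
    suc (palLen (1 + S * 4))            ∎

  palLen-1+S≤palLen-4S+2 : ∀ S n → S + 1 < n → PalLenBoundBelow (collapse a) n → palLen (suc S) ≤ palLen (2 + S * 4)
  palLen-1+S≤palLen-4S+2 S n S+1<n ih =
    subst (palLen (suc S) ≤_) (sym (palLen-4q+2 S))
      (m≤2+[n⊓m] (subst (λ m → palLen m ≤ suc (palLen S)) (+-comm S 1) (ih S 1 S+1<n (PalAt-1 (collapse a) S))))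

  palLen-4S+2+1 : ∀ S → PalLenBoundBelow (collapse a) ((2 + S * 4) + 1) → palLen ((2 + S * 4) + 1) ≤ suc (palLen (2 + S * 4))
  palLen-4S+2+1 S ih = begin
    palLen ((2 + S * 4) + 1) ≡⟨ cong palLen (e S) ⟩
    palLen (3 + S * 4)       ≡⟨ palLen-4q+3 S ⟩
    suc (palLen (suc S))     ≤⟨ s≤s (palLen-1+S≤palLen-4S+2 S _ (<-from-≡ (S * 3 + 1) (e′ S)) ih) ⟩
    suc (palLen (2 + S * 4)) ∎
    where e : ∀ S → (2 + S * 4) + 1 ≡ 3 + S * 4
          e = solve-∀
          e′ : ∀ S → (2 + S * 4) + 1 ≡ suc (S + 1 + (S * 3 + 1))
          e′ = solve-∀

  palLen-4S+2+3 : ∀ S → PalLenBoundBelow (collapse a) ((2 + S * 4) + 3) → palLen ((2 + S * 4) + 3) ≤ suc (palLen (2 + S * 4))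
  palLen-4S+2+3 S ih = begin
    palLen ((2 + S * 4) + 3) ≡⟨ cong palLen (e S) ⟩
    palLen (1 + suc S * 4)   ≡⟨ palLen-4q+1 (suc S) ⟩
    suc (palLen (suc S))     ≤⟨ s≤s (palLen-1+S≤palLen-4S+2 S _ (<-from-≡ (S * 3 + 3) (e′ S)) ih) ⟩
    suc (palLen (2 + S * 4)) ∎
    where e : ∀ S → (2 + S * 4) + 3 ≡ 1 + suc S * 4
          e = solve-∀
          e′ : ∀ S → (2 + S * 4) + 3 ≡ suc (S + 1 + (S * 3 + 3))
          e′ = solve-∀

  palLen-4S+3+1 : ∀ S → palLen ((3 + S * 4) + 1) ≤ suc (palLen (3 + S * 4))
  palLen-4S+3+1 S = begin
    palLen ((3 + S * 4) + 1)   ≡⟨ cong palLen (e S) ⟩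
    palLen (suc S * 4)         ≡⟨ palLen-4q (suc S) ⟩
    palLen (suc S)             ≤⟨ m≤n+m _ 2 ⟩
    2 + palLen (suc S)         ≡⟨ cong suc (palLen-4q+3 S) ⟨
    suc (palLen (3 + S * 4))   ∎
    where e : ∀ S → (3 + S * 4) + 1 ≡ suc S * 4
          e = solve-∀

  palLen-4S+3+3 : ∀ S → palLen ((3 + S * 4) + 3) ≤ suc (palLen (3 + S * 4))
  palLen-4S+3+3 S = begin
    palLen ((3 + S * 4) + 3)                       ≡⟨ cong palLen (e S) ⟩
    palLen (2 + suc S * 4)                         ≡⟨ palLen-4q+2 (suc S) ⟩
    2 + (palLen (suc S) ⊓ palLen (suc (suc S)))    ≤⟨ +-monoʳ-≤ 2 (m⊓n≤m _ _) ⟩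
    2 + palLen (suc S)                             ≡⟨ cong suc (palLen-4q+3 S) ⟨
    suc (palLen (3 + S * 4))                       ∎
    where e : ∀ S → (3 + S * 4) + 3 ≡ 2 + suc S * 4
          e = solve-∀

  -- A palindrome starting at 4S+1 or 4S+2 and ending at a symmetric offset extends,
  -- letter by letter using the block structure, to a palindrome made of whole blocks.
  PalAt-4S+1⇒PalAt-collapse : ∀ S L → PalAt a (1 + S * 4) (2 + L * 4) → PalAt (collapse a) S (suc L)
  PalAt-4S+1⇒PalAt-collapse S zero    pal = PalAt-1 (collapse a) S
  PalAt-4S+1⇒PalAt-collapse S (suc L) pal = PalAt-extend (collapse a) {S} inner (cong₂ _,_ firsts seconds)
    where
    inner : PalAt (collapse a) (suc S) L
    inner = PalAt⇒PalAt-collapse (suc S) L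
      (PalAt-inner a (3 + S * 4) (L * 4) (PalAt-inner a (2 + S * 4) (2 + L * 4) (PalAt-inner a (1 + S * 4) (4 + L * 4) pal)))
    e₂ : ∀ S → (1 + S * 4) + 2 ≡ 3 + S * 4
    e₂ = solve-∀
    e₃ : ∀ S L → (1 + S * 4) + (3 + L * 4) ≡ (S + suc L) * 4
    e₃ = solve-∀
    e₅ : ∀ S L → (1 + S * 4) + (5 + L * 4) ≡ 2 + (S + suc L) * 4
    e₅ = solve-∀
    firsts : a (S * 4) ≡ a ((S + suc L) * 4)
    firsts = trans (sym (fourth≡first S)) (PalAt-at pal 2 (3 + L * 4) refl (e₂ S) (e₃ S L))
    seconds : a (1 + S * 4) ≡ a (1 + (S + suc L) * 4)
    seconds = trans (PalAt-at pal 0 (5 + L * 4) refl (+-identityʳ _) (e₅ S L)) (third≡second (S + suc L))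

  palLen-4S+1+4L+2 : ∀ S L → PalLenBoundBelow (collapse a) ((1 + S * 4) + (2 + L * 4)) →
                     PalLenBound a (1 + S * 4) (2 + L * 4)
  palLen-4S+1+4L+2 S L ih pal = begin
    palLen ((1 + S * 4) + (2 + L * 4)) ≡⟨ cong palLen (e S L) ⟩
    palLen (3 + (S + L) * 4)           ≡⟨ palLen-4q+3 (S + L) ⟩
    suc (palLen (suc (S + L)))         ≡⟨ cong (suc ∘ palLen) (+-suc S L) ⟨
    suc (palLen (S + suc L))           ≤⟨ s≤s (ih S (suc L) (<-from-≡ (S * 3 + L * 3 + 1) (e′ S L)) (PalAt-4S+1⇒PalAt-collapse S L pal)) ⟩
    suc (suc (palLen S))               ≡⟨ cong suc (palLen-4q+1 S) ⟨
    suc (palLen (1 + S * 4))           ∎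
    where
    e : ∀ S L → (1 + S * 4) + (2 + L * 4) ≡ 3 + (S + L) * 4
    e = solve-∀
    e′ : ∀ S L → (1 + S * 4) + (2 + L * 4) ≡ suc ((S + suc L) + (S * 3 + L * 3 + 1))
    e′ = solve-∀

  PalAt-4S+2⇒PalAt-collapse-inner : ∀ S L → PalAt a (2 + S * 4) (suc L * 4) → PalAt (collapse a) (suc S) L
  PalAt-4S+2⇒PalAt-collapse-inner S L pal =
    PalAt⇒PalAt-collapse (suc S) L (PalAt-inner a (3 + S * 4) (L * 4) (PalAt-inner a (2 + S * 4) (2 + L * 4) pal))

  PalAt-4S+2⇒PalAt-collapse : ∀ S L → PalAt a (2 + S * 4) (suc L * 4) → PalAt (collapse a) S (2 + L)
  PalAt-4S+2⇒PalAt-collapse S L pal =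
    PalAt-extend (collapse a) {S} (PalAt-4S+2⇒PalAt-collapse-inner S L pal) (cong₂ _,_ firsts seconds)
    where
    e₂ : ∀ S L → (2 + S * 4) + (2 + L * 4) ≡ (S + suc L) * 4
    e₂ = solve-∀
    e₃ : ∀ S L → (2 + S * 4) + (3 + L * 4) ≡ 1 + (S + suc L) * 4
    e₃ = solve-∀
    firsts : a (S * 4) ≡ a ((S + suc L) * 4)
    firsts = trans (sym (fourth≡first S)) (PalAt-at pal 1 (2 + L * 4) refl (+-comm _ 1) (e₂ S L))
    seconds : a (1 + S * 4) ≡ a (1 + (S + suc L) * 4)
    seconds = trans (sym (third≡second S)) (PalAt-at pal 0 (3 + L * 4) refl (+-identityʳ _) (e₃ S L))

  palLen-4S+2+4L : ∀ S L → PalLenBoundBelow (collapse a) ((2 + S * 4) + suc L * 4) →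
                   PalLenBound a (2 + S * 4) (suc L * 4)
  palLen-4S+2+4L S L ih pal = begin
    palLen ((2 + S * 4) + suc L * 4)                        ≡⟨ cong palLen (e S L) ⟩
    palLen (2 + (S + suc L) * 4)                            ≡⟨ palLen-4q+2 (S + suc L) ⟩
    2 + (palLen (S + suc L) ⊓ palLen (suc (S + suc L)))     ≤⟨ +-monoʳ-≤ 2 (⊓-≤-suc inner outer) ⟩
    suc (2 + (palLen S ⊓ palLen (suc S)))                   ≡⟨ cong suc (palLen-4q+2 S) ⟨
    suc (palLen (2 + S * 4))                                ∎
    where
    e : ∀ S L → (2 + S * 4) + suc L * 4 ≡ 2 + (S + suc L) * 4
    e = solve-∀
    e-outer : ∀ S L → (2 + S * 4) + suc L * 4 ≡ suc ((S + (2 + L)) + (S * 3 + L * 3 + 3))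
    e-outer = solve-∀
    e-inner : ∀ S L → (2 + S * 4) + suc L * 4 ≡ suc ((suc S + L) + (S * 3 + L * 3 + 4))
    e-inner = solve-∀
    outer : palLen (suc (S + suc L)) ≤ suc (palLen S)
    outer = subst (λ n → palLen n ≤ suc (palLen S)) (+-suc S (suc L))
      (ih S (2 + L) (<-from-≡ _ (e-outer S L)) (PalAt-4S+2⇒PalAt-collapse S L pal))
    inner : palLen (S + suc L) ≤ suc (palLen (suc S))
    inner = subst (λ n → palLen n ≤ suc (palLen (suc S))) (sym (+-suc S L))
      (ih (suc S) L (<-from-≡ _ (e-inner S L)) (PalAt-4S+2⇒PalAt-collapse-inner S L pal))

  palLen-4S+3+4L+2 : ∀ S L → PalLenBoundBelow (collapse a) ((3 + S * 4) + (2 + L * 4)) →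
                     PalLenBound a (3 + S * 4) (2 + L * 4)
  palLen-4S+3+4L+2 S L ih pal = begin
    palLen ((3 + S * 4) + (2 + L * 4)) ≡⟨ cong palLen (e S L) ⟩
    palLen (1 + suc (S + L) * 4)       ≡⟨ palLen-4q+1 (suc (S + L)) ⟩
    suc (palLen (suc S + L))           ≤⟨ s≤s (ih (suc S) L (<-from-≡ _ (e′ S L)) collapsed) ⟩
    suc (suc (palLen (suc S)))         ≡⟨ cong suc (palLen-4q+3 S) ⟨
    suc (palLen (3 + S * 4))           ∎
    where
    e : ∀ S L → (3 + S * 4) + (2 + L * 4) ≡ 1 + suc (S + L) * 4
    e = solve-∀
    e′ : ∀ S L → (3 + S * 4) + (2 + L * 4) ≡ suc ((suc S + L) + (S * 3 + L * 3 + 3))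
    e′ = solve-∀
    collapsed : PalAt (collapse a) (suc S) L
    collapsed = PalAt⇒PalAt-collapse (suc S) L (PalAt-inner a (3 + S * 4) (L * 4) pal)

palLen-palindrome-acc : ∀ {A : Set} (a : ℕ → A) → InC a → ∀ s l → Acc _<_ (s + l) → PalLenBound a s l
palLen-palindrome-acc a a∈C s l (acc below) = cases (mod4 s) (mod4 l) ih
  where
  open BlockPalindromes a (InC⇒Blocks a a∈C)
  open PalLenCases a (InC⇒Blocks a a∈C)
  ih : PalLenBoundBelow (collapse a) (s + l)
  ih s′ l′ lt = palLen-palindrome-acc (collapse a) (InC-collapse a a∈C) s′ l′ (below lt)
  cases : ∀ {s l} → Mod4 s → Mod4 l → PalLenBoundBelow (collapse a) (s + l) → PalLenBound a s l
  cases (4q S)   (4q zero)     _  _   = palLen-+0 (S * 4)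
  cases (4q S)   (4q (suc L))  ih pal = palLen-4S+4L S L ih pal
  cases (4q S)   (4q+1 zero)   _  _   = palLen-4S+1 S
  cases (4q S)   (4q+1 (suc L)) _ pal = ⊥-elim (¬PalAt-5+4L _ L pal)
  cases (4q S)   (4q+2 L)      _  pal = ⊥-elim (¬PalAt-4S-4L+2 S L pal)
  cases (4q S)   (4q+3 zero)   _  pal = ⊥-elim (¬PalAt-4S-3 S pal)
  cases (4q S)   (4q+3 (suc L)) _ pal = ⊥-elim (¬PalAt-7+4L _ L pal)
  cases (4q+1 S) (4q zero)     _  _   = palLen-+0 (1 + S * 4)
  cases (4q+1 S) (4q (suc L))  _  pal = ⊥-elim (¬PalAt-4S+1-4L+4 S L pal)
  cases (4q+1 S) (4q+1 zero)   _  _   = palLen-4S+1+1 S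
  cases (4q+1 S) (4q+1 (suc L)) _ pal = ⊥-elim (¬PalAt-5+4L _ L pal)
  cases (4q+1 S) (4q+2 L)      ih pal = palLen-4S+1+4L+2 S L ih pal
  cases (4q+1 S) (4q+3 zero)   _  pal = ⊥-elim (¬PalAt-4S+1-3 S pal)
  cases (4q+1 S) (4q+3 (suc L)) _ pal = ⊥-elim (¬PalAt-7+4L _ L pal)
  cases (4q+2 S) (4q zero)     _  _   = palLen-+0 (2 + S * 4)
  cases (4q+2 S) (4q (suc L))  ih pal = palLen-4S+2+4L S L ih pal
  cases (4q+2 S) (4q+1 zero)   ih _   = palLen-4S+2+1 S ih
  cases (4q+2 S) (4q+1 (suc L)) _ pal = ⊥-elim (¬PalAt-5+4L _ L pal)
  cases (4q+2 S) (4q+2 L)      _  pal = ⊥-elim (¬PalAt-4S+2-4L+2 S L pal)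
  cases (4q+2 S) (4q+3 zero)   ih _   = palLen-4S+2+3 S ih
  cases (4q+2 S) (4q+3 (suc L)) _ pal = ⊥-elim (¬PalAt-7+4L _ L pal)
  cases (4q+3 S) (4q zero)     _  _   = palLen-+0 (3 + S * 4)
  cases (4q+3 S) (4q (suc L))  _  pal = ⊥-elim (¬PalAt-4S+3-4L+4 S L pal)
  cases (4q+3 S) (4q+1 zero)   _  _   = palLen-4S+3+1 S
  cases (4q+3 S) (4q+1 (suc L)) _ pal = ⊥-elim (¬PalAt-5+4L _ L pal)
  cases (4q+3 S) (4q+2 L)      ih pal = palLen-4S+3+4L+2 S L ih pal
  cases (4q+3 S) (4q+3 zero)   _  _   = palLen-4S+3+3 S
  cases (4q+3 S) (4q+3 (suc L)) _ pal = ⊥-elim (¬PalAt-7+4L _ L pal)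

palLen-palindrome : ∀ {A : Set} (a : ℕ → A) → InC a → ∀ s l → PalLenBound a s l
palLen-palindrome a a∈C s l = palLen-palindrome-acc a a∈C s l (<-wellFounded (s + l))

-- Optimal decompositions with admissible factors

Admissible : {A : Set} → (ℕ → A) → ℕ → ℕ → Set
Admissible a x l = (l ≢ 3) × (2 ∣ l → ∃[ z ] ∃[ r ] (Palindrome (factor a (4 * z) (4 * r)) × EmbeddedCenter x l (4 * z) (4 * r)))

embedded-centre : ∀ X l d → EmbeddedCenter (d + X) l X (d + (l + d))
embedded-centre X l d =
  m≤n+m X d ,
  ≤-trans (m≤m+n ((d + X) + l) d) (≤-reflexive (sym (e X l d))) ,
  trans (m+n∸n≡m d X) (sym (trans (cong (_∸ ((d + X) + l)) (e X l d)) (m+n∸m≡n ((d + X) + l) d)))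
  where
  e : ∀ X l d → X + (d + (l + d)) ≡ (d + X) + l + d
  e = solve-∀

module _ {A : Set} (a : ℕ → A) where

  admissible-1 : ∀ x → Admissible a x 1
  admissible-1 x = (λ ()) , λ 2∣1 → contradiction (∣1⇒≡1 2∣1) (λ ())

  admissible-centred : ∀ X L d l → PalAt a (X * 4) (L * 4) → d + (l + d) ≡ L * 4 → l ≢ 3 → Admissible a (d + X * 4) l
  admissible-centred X L d l pal d+l+d≡4L l≢3 = l≢3 , λ _ → X , L ,
    subst₂ (λ y m → Palindrome (factor a y m)) (*-comm X 4) (*-comm L 4) (PalAt⇒Palindrome a (X * 4) (L * 4) pal) ,
    subst₂ (EmbeddedCenter (d + X * 4) l) (*-comm X 4) (trans d+l+d≡4L (*-comm L 4)) (embedded-centre (X * 4) l d)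

  data AdmissibleDecomp : ℕ → ℕ → Set where
    []   : AdmissibleDecomp 0 0
    snoc : ∀ {x c} → AdmissibleDecomp x c → ∀ l → 0 < l → PalAt a x l → Admissible a x l →
           AdmissibleDecomp (x + l) (suc c)

  snoc-letter : ∀ {x c} → AdmissibleDecomp x c → AdmissibleDecomp (1 + x) (suc c)
  snoc-letter {x} {c} d = subst (λ n → AdmissibleDecomp n (suc c)) (+-comm x 1) (snoc d 1 (s≤s z≤n) (PalAt-1 a x) (admissible-1 x))

module Refine {A : Set} (a : ℕ → A) (blocks : Blocks a) where
  open BlockPalindromes a blocks

  scale : ∀ {x c} → AdmissibleDecomp (collapse a) x c → AdmissibleDecomp a (x * 4) c
  scale [] = []
  scale {c = suc c} (snoc {x} d (suc l) _ pal _) =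
    subst (λ n → AdmissibleDecomp a n (suc c)) (sym (*-distribʳ-+ 4 x (suc l)))
      (snoc (scale d) (suc l * 4) (s≤s z≤n) whole
        (admissible-centred a x (suc l) 0 (suc l * 4) whole (+-identityʳ _) (r+q*4≢s+p*4 0 3 (suc l) 0 (λ ()))))
    where whole = PalAt-collapse⇒PalAt x (suc l) pal

  -- Scaling a decomposition of the collapsed prefix of length q+1 covers 4q+4 letters; its
  -- last factor, a palindrome of 4l+4 letters, is replaced by its first letter and the
  -- palindrome of 4l+2 letters centred in it.
  refine-4q+3 : ∀ {n c} q → AdmissibleDecomp (collapse a) n c → n ≡ suc q → AdmissibleDecomp a (3 + q * 4) (suc c)
  refine-4q+3 q (snoc {x} {c} d (suc l) _ pal _) x+l+1≡q+1 =
    subst (λ n → AdmissibleDecomp a n (2 + c)) (trans (e x l) (cong (λ m → 3 + m * 4) x+l≡q))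
      (snoc (snoc-letter a (scale d)) (2 + l * 4) (s≤s z≤n) (PalAt-inner a (x * 4) (2 + l * 4) whole)
        (admissible-centred a x (suc l) 1 (2 + l * 4) whole (e′ l) (r+q*4≢s+p*4 2 3 l 0 (λ ()))))
    where
    whole = PalAt-collapse⇒PalAt x (suc l) pal
    x+l≡q : x + l ≡ q
    x+l≡q = suc-injective (trans (sym (+-suc x l)) x+l+1≡q+1)
    e : ∀ x l → (1 + x * 4) + (2 + l * 4) ≡ 3 + (x + l) * 4
    e = solve-∀
    e′ : ∀ l → 1 + ((2 + l * 4) + 1) ≡ suc l * 4
    e′ = solve-∀

  -- Likewise, the last factor (4l+8 letters) is replaced by its first two letters and the
  -- palindrome of 4l+4 letters centred in it, or just by two letters if it is a single block.
  refine-4q+2 : ∀ {n c} q → AdmissibleDecomp (collapse a) n c → n ≡ suc q →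
                Σ ℕ λ c′ → AdmissibleDecomp a (2 + q * 4) c′ × c′ ≤ 2 + c
  refine-4q+2 q (snoc {x} {c} d 1 _ _ _) x+1≡q+1 =
    2 + c ,
    subst (λ y → AdmissibleDecomp a (2 + y * 4) (2 + c)) x≡q (snoc-letter a (snoc-letter a (scale d))) ,
    n≤1+n _
    where x≡q = suc-injective (trans (+-comm 1 x) x+1≡q+1)
  refine-4q+2 q (snoc {x} {c} d (suc (suc l)) _ pal _) x+l+2≡q+1 =
    3 + c ,
    subst (λ n → AdmissibleDecomp a n (3 + c)) (trans (e x l) (cong (λ m → 2 + m * 4) x+l+1≡q))
      (snoc (snoc-letter a (snoc-letter a (scale d))) (suc l * 4) (s≤s z≤n) inner
        (admissible-centred a x (2 + l) 2 (suc l * 4) whole (e′ l) (r+q*4≢s+p*4 0 3 (suc l) 0 (λ ())))) ,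
    ≤-refl
    where
    whole = PalAt-collapse⇒PalAt x (2 + l) pal
    inner = PalAt-inner a (1 + x * 4) (suc l * 4) (PalAt-inner a (x * 4) (2 + suc l * 4) whole)
    x+l+1≡q : x + suc l ≡ q
    x+l+1≡q = suc-injective (trans (sym (+-suc x (suc l))) x+l+2≡q+1)
    e : ∀ x l → (2 + x * 4) + suc l * 4 ≡ 2 + (x + suc l) * 4
    e = solve-∀
    e′ : ∀ l → 2 + (suc l * 4 + 2) ≡ (2 + l) * 4
    e′ = solve-∀

Decomposable : {A : Set} → (ℕ → A) → ℕ → Set
Decomposable a n = Σ ℕ λ c → AdmissibleDecomp a n c × c ≤ palLen n

decomposable-acc : ∀ {A : Set} (a : ℕ → A) → InC a → ∀ n → Acc _<_ n → Decomposable a n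
decomposable-acc a a∈C n (acc below) = cases (mod4 n) ih
  where
  open Refine a (InC⇒Blocks a a∈C)
  ih : ∀ m → m < n → Decomposable (collapse a) m
  ih m m<n = decomposable-acc (collapse a) (InC-collapse a a∈C) m (below m<n)
  cases : ∀ {n} → Mod4 n → (∀ m → m < n → Decomposable (collapse a) m) → Decomposable a n
  cases (4q zero) _ = 0 , [] , z≤n
  cases (4q (suc q)) ih with ih (suc q) (<-from-≡ (2 + q * 3) (e q))
    where e : ∀ q → suc q * 4 ≡ suc (suc q + (2 + q * 3))
          e = solve-∀
  ... | c , d , c≤ = c , scale d , subst (c ≤_) (sym (palLen-4q (suc q))) c≤
  cases (4q+1 q) ih with ih q (<-from-≡ (q * 3) (e q))
    where e : ∀ q → 1 + q * 4 ≡ suc (q + q * 3)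
          e = solve-∀
  ... | c , d , c≤ = suc c , snoc-letter a (scale d) , subst (suc c ≤_) (sym (palLen-4q+1 q)) (s≤s c≤)
  cases (4q+3 q) ih with ih (suc q) (<-from-≡ (1 + q * 3) (e q))
    where e : ∀ q → 3 + q * 4 ≡ suc (suc q + (1 + q * 3))
          e = solve-∀
  ... | c , d , c≤ = suc c , refine-4q+3 q d refl , subst (suc c ≤_) (sym (palLen-4q+3 q)) (s≤s c≤)
  cases (4q+2 q) ih with palLen q ≤? palLen (suc q)
  ... | yes pl[q]≤pl[q+1] with ih q (<-from-≡ (1 + q * 3) (e q))
    where e : ∀ q → 2 + q * 4 ≡ suc (q + (1 + q * 3))
          e = solve-∀
  ... | c , d , c≤ =
    2 + c , snoc-letter a (snoc-letter a (scale d)) ,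
    subst (2 + c ≤_) (sym (trans (palLen-4q+2 q) (cong (2 +_) (m≤n⇒m⊓n≡m pl[q]≤pl[q+1])))) (+-monoʳ-≤ 2 c≤)
  cases (4q+2 q) ih | no pl[q]≰pl[q+1] with ih (suc q) (<-from-≡ (q * 3) (e q))
    where e : ∀ q → 2 + q * 4 ≡ suc (suc q + q * 3)
          e = solve-∀
  ... | c , d , c≤ with refine-4q+2 q d refl
  ... | c′ , d′ , c′≤ = c′ , d′ ,
    subst (c′ ≤_) (sym (trans (palLen-4q+2 q) (cong (2 +_) (m≥n⇒m⊓n≡n (≰⇒≥ pl[q]≰pl[q+1])))))
      (≤-trans c′≤ (+-monoʳ-≤ 2 c≤))

decomposable : ∀ {A : Set} (a : ℕ → A) → InC a → ∀ n → Decomposable a n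
decomposable a a∈C n = decomposable-acc a a∈C n (<-wellFounded n)

module _ {A : Set} (a : ℕ → A) where

  PalDecomp-∷ʳ : ∀ {x l} ls → PalDecomp a x ls → 0 < l → Palindrome (factor a (x + sum ls) l) →
                 PalDecomp a x (ls ++ l ∷ [])
  PalDecomp-∷ʳ {x} {l} [] pd-nil 0<l pal =
    pd-cons 0<l (subst (λ y → Palindrome (factor a y l)) (+-identityʳ x) pal) pd-nil
  PalDecomp-∷ʳ {x} {l} (l₀ ∷ ls) (pd-cons 0<l₀ pal₀ rest) 0<l pal =
    pd-cons 0<l₀ pal₀ (PalDecomp-∷ʳ ls rest 0<l (subst (λ y → Palindrome (factor a y l)) (sym (+-assoc x l₀ (sum ls))) pal))

  toPalDecomp : ∀ {n c} → AdmissibleDecomp a n c →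
                Σ (List ℕ) λ ls → IsPalDecompPrefix a n ls × AllFactors (Admissible a) 0 ls × length ls ≡ c
  toPalDecomp [] = [] , (pd-nil , refl) , af-nil , refl
  toPalDecomp (snoc {x} d l 0<l pal adm) with toPalDecomp d
  ... | ls , (pd , sum≡x) , adms , len≡c =
    ls ++ l ∷ [] ,
    (PalDecomp-∷ʳ ls pd 0<l (subst (λ y → Palindrome (factor a y l)) (sym sum≡x) (PalAt⇒Palindrome a x l pal)) ,
     trans (sum-++ ls (l ∷ [])) (cong₂ _+_ sum≡x (+-identityʳ l))) ,
    AllFactors-∷ʳ ls adms (subst (λ y → Admissible a y l) (sym sum≡x) adm) ,
    trans (length-++ ls) (trans (+-comm (length ls) 1) (cong suc len≡c))
    where
    AllFactors-∷ʳ : ∀ {P : ℕ → ℕ → Set} {y l} ls → AllFactors P y ls → P (y + sum ls) l → AllFactors P y (ls ++ l ∷ [])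
    AllFactors-∷ʳ {P} {y} {l} [] af-nil p = af-cons (subst (λ z → P z l) (+-identityʳ y) p) af-nil
    AllFactors-∷ʳ {P} {y} {l} (l₀ ∷ ls) (af-cons p₀ rest) p =
      af-cons p₀ (AllFactors-∷ʳ ls rest (subst (λ z → P z l) (sym (+-assoc y l₀ (sum ls))) p))

palLen≤length : ∀ {A : Set} (a : ℕ → A) → InC a → ∀ {x} ls → PalDecomp a x ls → palLen (x + sum ls) ≤ palLen x + length ls
palLen≤length a a∈C {x} [] pd-nil = ≤-reflexive (trans (cong palLen (+-identityʳ x)) (sym (+-identityʳ (palLen x))))
palLen≤length a a∈C {x} (l ∷ ls) (pd-cons _ pal rest) = begin
  palLen (x + (l + sum ls))      ≡⟨ cong palLen (+-assoc x l (sum ls)) ⟨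
  palLen ((x + l) + sum ls)      ≤⟨ palLen≤length a a∈C ls rest ⟩
  palLen (x + l) + length ls     ≤⟨ +-monoˡ-≤ (length ls) (palLen-palindrome a a∈C x l (Palindrome⇒PalAt a x l pal)) ⟩
  suc (palLen x) + length ls     ≡⟨ +-suc (palLen x) (length ls) ⟨
  palLen x + suc (length ls)     ∎
  where open ≤-Reasoning

lemma5 : (A : Set) → (Σ A λ b → Σ A λ c → b ≢ c) →
  (a : ℕ → A) → InC a → (k : ℕ) → 1 ≤ k →
  Σ (List ℕ) λ ls →
    IsOptimalPalDecompPrefix a k ls ×
    AllFactors (λ x l → (l ≢ 3) ×
      (2 ∣ l → ∃[ z ] ∃[ r ] (Palindrome (factor a (4 * z) (4 * r)) ×
                               EmbeddedCenter x l (4 * z) (4 * r))))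
      0 ls
lemma5 A _ a a∈C k _ with decomposable a a∈C k
... | c , d , c≤palLen with toPalDecomp a d
... | ls , decomp , admissible , len≡c = ls , (decomp , optimal) , admissible
  where
  optimal : (ms : List ℕ) → IsPalDecompPrefix a k ms → length ls ≤ length ms
  optimal ms (pd , sum≡k) = begin
    length ls                    ≡⟨ len≡c ⟩
    c                            ≤⟨ c≤palLen ⟩
    palLen k                     ≡⟨ cong palLen sum≡k ⟨
    palLen (0 + sum ms)          ≤⟨ palLen≤length a a∈C ms pd ⟩
    length ms                    ∎
    where open ≤-Reasoning
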